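{- Let $n$ be a positive integer and $S\subseteq E_n$. Let $\widetilde{S}$ be the system obtained from $S$ by removing each equation of the form $x_i=1$ belonging to $S$ and adding, for each such $i$, the $n$ equations $x_i\cdot x_1=x_1,\ \ldots,\ x_i\cdot x_n=x_n$; that is, $\widetilde{S}=(S\setminus\{x_i=1: i\in\{1,\ldots,n\}\})\cup\{x_i\cdot x_j=x_j: i,j\in\{1,\ldots,n\}\text{ and the equation } x_i=1 \text{ belongs to } S\}$. Then the set of integer solutions $(x_1,\ldots,x_n)\in\mathbb{Z}^n$ of $\widetilde{S}$ equals the set of integer solutions of $S$ union $\{(0,\ldots,0)\}$.
   Context: For a positive integer $n$, $E_n=\{x_i=1,\ x_i+x_j=x_k,\ x_i\cdot x_j=x_k:\ i,j,k\in\{1,\ldots,n\}\}$; a system $S\subseteq E_n$ is a set of such equations in the variables $x_1,\ldots,x_n$. -}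

module Defs where

open import Data.Nat using (ℕ)
open import Data.Fin using (Fin)
open import Data.Integer using (ℤ; _+_; _*_; 1ℤ; 0ℤ)
open import Data.Product using (_×_; ∃; ∃-syntax)
open import Data.Sum using (_⊎_)
open import Relation.Binary.PropositionalEquality using (_≡_)
open import Relation.Nullary using (¬_)

data Equation (n : ℕ) : Set where
  one : Fin n → Equation n
  add : Fin n → Fin n → Fin n → Equation n
  mul : Fin n → Fin n → Fin n → Equation n

System : ℕ → Set₁
System n = Equation n → Set

Satisfies : {n : ℕ} → (Fin n → ℤ) → Equation n → Set
Satisfies x (one i)     = x i ≡ 1ℤ
Satisfies x (add i j k) = x i + x j ≡ x k
Satisfies x (mul i j k) = x i * x j ≡ x k

IsSolution : {n : ℕ} → System n → (Fin n → ℤ) → Set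
IsSolution S x = ∀ e → S e → Satisfies x e

IsOneEq : {n : ℕ} → Equation n → Set
IsOneEq e = ∃[ i ] e ≡ one i

tilde : {n : ℕ} → System n → System n
tilde {n} S e =
  (S e × ¬ IsOneEq e) ⊎ (∃[ i ] ∃[ j ] (S (one i) × e ≡ mul i j j))

IsZero : {n : ℕ} → (Fin n → ℤ) → Set
IsZero x = ∀ i → x i ≡ 0ℤ

module Submission where

-- The equations x_i · x_j = x_j (for x_i = 1 in S) are
-- exactly what is needed to recover x_i = 1 from any coordinate x_j ≠ 0,
-- by cancelling x_j in ℤ.  Hence:
--   * if x solves S̃ and x ≠ (0,…,0), pick j with x_j ≠ 0; then every
--     x_i = 1 of S holds, and the other equations of S are kept in S̃;
--   * if x solves S, the new equations read 1 · x_j = x_j;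
--   * the zero tuple solves every equation of the forms x_i + x_j = x_k and
--     x_i · x_j = x_k, and S̃ contains only such equations.

open import Defs
open import Data.Nat using (ℕ; NonZero)
open import Data.Fin using (Fin)
open import Data.Fin.Properties using (all?; ¬∀⟶∃¬)
open import Data.Integer using (ℤ; 0ℤ; 1ℤ; _+_; _*_; ≢-nonZero)
open import Data.Integer.Properties using (_≟_; *-cancelʳ-≡; *-identityˡ)
open import Data.Sum using (_⊎_; inj₁; inj₂)
open import Data.Product using (_×_; _,_; ∃-syntax)
open import Data.Empty using (⊥-elim)
open import Relation.Nullary using (yes; no; ¬_)
open import Relation.Binary.PropositionalEquality using (_≡_; refl; sym; trans; cong₂)

unit-of-fixed-nonzero : ∀ a b → ¬ b ≡ 0ℤ → a * b ≡ b → a ≡ 1ℤ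
unit-of-fixed-nonzero a b b≢0 ab≡b =
  *-cancelʳ-≡ a 1ℤ b {{≢-nonZero b≢0}} (trans ab≡b (sym (*-identityˡ b)))

zero-or-nonzero-coordinate : {n : ℕ} (x : Fin n → ℤ) → IsZero x ⊎ ∃[ j ] ¬ x j ≡ 0ℤ
zero-or-nonzero-coordinate {n} x with all? (λ i → x i ≟ 0ℤ)
... | yes x≡0 = inj₁ x≡0
... | no  x≢0 = inj₂ (¬∀⟶∃¬ n (λ i → x i ≡ 0ℤ) (λ i → x i ≟ 0ℤ) x≢0)

zero-satisfies : {n : ℕ} (x : Fin n → ℤ) → IsZero x →
  (e : Equation n) → ¬ IsOneEq e → Satisfies x e
zero-satisfies x x≡0 (one i)     notOne = ⊥-elim (notOne (i , refl))
zero-satisfies x x≡0 (add i j k) _ =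
  trans (cong₂ _+_ (x≡0 i) (x≡0 j)) (sym (x≡0 k))
zero-satisfies x x≡0 (mul i j k) _ =
  trans (cong₂ _*_ (x≡0 i) (x≡0 j)) (sym (x≡0 k))

tilde-has-no-one-eq : {n : ℕ} (S : System n) (e : Equation n) → tilde S e → ¬ IsOneEq e
tilde-has-no-one-eq S e (inj₁ (_ , notOne))            = notOne
tilde-has-no-one-eq S e (inj₂ (_ , _ , _ , refl)) (_ , ())

kept-in-tilde : {n : ℕ} (S : System n) (e : Equation n) →
  S e → ¬ IsOneEq e → tilde S e
kept-in-tilde S e s notOne = inj₁ (s , notOne)

tilde-solution-with-nonzero : {n : ℕ} (S : System n) (x : Fin n → ℤ) (j : Fin n) →
  ¬ x j ≡ 0ℤ → IsSolution (tilde S) x → IsSolution S x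
tilde-solution-with-nonzero S x j xj≢0 sol (one i) s =
  unit-of-fixed-nonzero (x i) (x j) xj≢0 (sol (mul i j j) (inj₂ (i , j , s , refl)))
tilde-solution-with-nonzero S x j _ sol e@(add _ _ _) s =
  sol e (kept-in-tilde S e s λ ())
tilde-solution-with-nonzero S x j _ sol e@(mul _ _ _) s =
  sol e (kept-in-tilde S e s λ ())

solution-solves-tilde : {n : ℕ} (S : System n) (x : Fin n → ℤ) →
  IsSolution S x → IsSolution (tilde S) x
solution-solves-tilde S x sol e (inj₁ (s , _)) = sol e s
solution-solves-tilde S x sol _ (inj₂ (i , j , s , refl))
  rewrite sol (one i) s = *-identityˡ (x j)

zero-solves-tilde : {n : ℕ} (S : System n) (x : Fin n → ℤ) →
  IsZero x → IsSolution (tilde S) x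
zero-solves-tilde S x x≡0 e e∈S̃ = zero-satisfies x x≡0 e (tilde-has-no-one-eq S e e∈S̃)

lemma2 : (n : ℕ) → .{{_ : NonZero n}} → (S : System n) → (x : Fin n → ℤ) →
    (IsSolution (tilde S) x → IsSolution S x ⊎ IsZero x) ×
    (IsSolution S x ⊎ IsZero x → IsSolution (tilde S) x)
lemma2 n S x = forward , backward
  where
  forward : IsSolution (tilde S) x → IsSolution S x ⊎ IsZero x
  forward sol with zero-or-nonzero-coordinate x
  ... | inj₁ x≡0         = inj₂ x≡0
  ... | inj₂ (j , xj≢0) = inj₁ (tilde-solution-with-nonzero S x j xj≢0 sol)

  backward : IsSolution S x ⊎ IsZero x → IsSolution (tilde S) x
  backward (inj₁ sol) = solution-solves-tilde S x sol
  backward (inj₂ x≡0) = zero-solves-tilde S x x≡0
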